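{- Let $a,b$ be positive integers, let $P=[a]\times[b]$ (with $[n]=\{1,\dots,n\}$ and componentwise order), let $\mathbb{K}$ be a field of characteristic zero and $C\in\mathbb{K}$ a generic constant. For a (generic) labeling $g\in\mathbb{K}^P$, the Stanley--Thomas words satisfy $\operatorname{ST}_{\operatorname{BAR}(g)}(i)=\operatorname{ST}_g(i-1)$ for $2\leq i\leq a+b$ and $\operatorname{ST}_{\operatorname{BAR}(g)}(1)=\operatorname{ST}_g(a+b)$.
   Context: $\mathbb{K}^P$ is the set of labelings $g:P\to\mathbb{K}$; all maps below are birational (rational) maps, defined for generic labelings. In $P=[a]\times[b]$, $(i,j)$ is covered exactly by $(i+1,j)$ and $(i,j+1)$ (when these lie in $P$). Define: $(\Theta f)(x)=C/f(x)$; $(\nabla f)(x)=f(x)/\sum_{y\lessdot x}f(y)$, where the empty sum (for $x$ minimal) is replaced by $1$; $(\Delta^{ -1}f)(x)=\sum f(y_1)f(y_2)\cdots f(y_k)$ over all saturated chains $x=y_1\lessdot y_2\lessdot\cdots\lessdot y_k$ with $y_k$ maximal in $P$, equivalently $(\Delta^{ -1}f)(x)=f(x)\sum_{y\gtrdot x}(\Delta^{ -1}f)(y)$ with the empty sum equal to $1$. Birational antichain rowmotion is $\operatorname{BAR}=\nabla\circ\Theta\circ\Delta^{ -1}$. The Stanley--Thomas word of $g$ is the $(a+b)$-tuple with $\operatorname{ST}_g(i)=g(i,1)g(i,2)\cdots g(i,b)$ for $1\le i\le a$ and $\operatorname{ST}_g(i)=C/\big(g(1,i-a)g(2,i-a)\cdots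 g(a,i-a)\big)$ for $a+1\le i\le a+b$. -}

module Defs where

open import Level using (Level; _⊔_) renaming (suc to lsuc)
open import Data.Nat using (ℕ; zero; suc; _∸_; _≤_; _<_; _≤?_; _<?_) renaming (_+_ to _ℕ+_)
open import Data.Fin using (Fin; zero; suc; toℕ; fromℕ<; inject₁)
open import Data.Product using (_×_)
open import Relation.Nullary using (¬_; yes; no)
open import Algebra.Bundles using (CommutativeRing)

-- The inverse is given as a total
-- operation; its value at 0 is unspecified and is never used below
-- (all denominators are assumed nonzero in the theorem).
record Field c ℓ : Set (lsuc (c ⊔ ℓ)) where
  field
    commutativeRing : CommutativeRing c ℓ
  open CommutativeRing commutativeRing public
  field
    _⁻¹      : Carrier → Carrier
    inverseʳ : ∀ x → ¬ (x ≈ 0#) → (x * (x ⁻¹)) ≈ 1#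
    1≉0      : ¬ (1# ≈ 0#)

module FieldOps {c ℓ} (K : Field c ℓ) where
  open Field K using (Carrier; _≈_; _+_; _*_; 0#; 1#; _⁻¹)

  natK : ℕ → Carrier
  natK zero    = 0#
  natK (suc n) = 1# + natK n

  CharZero : Set ℓ
  CharZero = ∀ n → ¬ (natK (suc n) ≈ 0#)

  prodFin : ∀ {n} → (Fin n → Carrier) → Carrier
  prodFin {zero}  f = 1#
  prodFin {suc n} f = f zero * prodFin (λ k → f (suc k))

module Poset {c ℓ} (K : Field c ℓ) (a b : ℕ) where
  open Field K using (Carrier; _≈_; _+_; _*_; 0#; 1#; _⁻¹)
  open FieldOps K

  -- P = [a] × [b], encoded 0-indexed as Fin a × Fin b: element (i , j)
  -- stands for (i+1 , j+1).  Labelings g : P → K.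
  Lab : Set c
  Lab = Fin a → Fin b → Carrier

  -- extension of a labeling to ℕ × ℕ (0 outside P; only used inside P)
  ext : Lab → ℕ → ℕ → Carrier
  ext g i j with i <? a | j <? b
  ... | yes i<a | yes j<b = g (fromℕ< i<a) (fromℕ< j<b)
  ... | _       | _       = 0#

  Θ : Carrier → Lab → Lab
  Θ C f i j = C * (f i j ⁻¹)

  -- Δ⁻¹, computed in "distance from the top" coordinates
  -- p = a-1-i, q = b-1-j (0-indexed); the upper covers of the element at
  -- distance (p,q) are those at distance (p-1,q) and (p,q-1) when these
  -- exist; the element is maximal iff p = q = 0.
  -- Dist h p q = h p q * (sum over upper covers, or 1 if none).
  Dist : (ℕ → ℕ → Carrier) → ℕ → ℕ → Carrier
  Dist h zero    zero    = h zero zero * 1#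
  Dist h (suc p) zero    = h (suc p) zero * Dist h p zero
  Dist h zero    (suc q) = h zero (suc q) * Dist h zero q
  Dist h (suc p) (suc q) = h (suc p) (suc q) * (Dist h p (suc q) + Dist h (suc p) q)

  Δinv : Lab → Lab
  Δinv f i j = Dist (λ p q → ext f (a ∸ suc p) (b ∸ suc q))
                    (a ∸ suc (toℕ i)) (b ∸ suc (toℕ j))

  -- sum of f over the lower covers of (i , j); 1 if (i , j) is minimal
  lowerSum : ∀ {m n} → (Fin m → Fin n → Carrier) → Fin m → Fin n → Carrier
  lowerSum f zero    zero    = 1#
  lowerSum f (suc i) zero    = f (inject₁ i) zero
  lowerSum f zero    (suc j) = f zero (inject₁ j)
  lowerSum f (suc i) (suc j) = f (inject₁ i) (suc j) + f (suc i) (inject₁ j)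

  ∇ : Lab → Lab
  ∇ f i j = f i j * (lowerSum f i j ⁻¹)

  BAR : Carrier → Lab → Lab
  BAR C g = ∇ (Θ C (Δinv g))

  -- Stanley–Thomas word, 1-indexed: ST C g i for 1 ≤ i ≤ a + b
  -- (value 0 outside this range, never used).
  ST : Carrier → Lab → ℕ → Carrier
  ST C g i with 1 ≤? i | i ≤? a | i ≤? a ℕ+ b
  ... | yes _ | yes _ | _     = prodFin {b} (λ j → ext g (i ∸ 1) (toℕ j))
  ... | yes _ | no _  | yes _ = C * (prodFin {a} (λ k → ext g (toℕ k) (i ∸ a ∸ 1)) ⁻¹)
  ... | _     | _     | _     = 0#

  -- Genericity / definedness conditions: every division performed in
  -- computing BAR(g), ST_g and ST_{BAR(g)} has a nonzero denominator.
  Generic : Carrier → Lab → Set ℓ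
  Generic C g =
      (¬ (C ≈ 0#))
    × (∀ i j → ¬ (g i j ≈ 0#))
    × (∀ i j → ¬ (Δinv g i j ≈ 0#))
    × (∀ i j → ¬ (lowerSum (Θ C (Δinv g)) i j ≈ 0#))
    × (∀ i j → ¬ (BAR C g i j ≈ 0#))

module Submission where

-- Write D = Δ⁻¹ g and β = BAR g, 0-indexed on Fin a × Fin b. Unfolding ∇ ∘ Θ gives
-- β(i,j) D(i,j) = C / L(i,j), where L(i,j) is the sum of C / D over the lower covers
-- of (i,j) (and 1 at the minimum). With the recursion D(i,j) = g(i,j) (D(i+1,j) + D(i,j+1))
-- this turns into multiplicative local relations: β(0,0) D(0,0) = C,
-- β(i+1,0) D(i+1,0) = D(i,0), and β(i+1,j+1) D(i+1,j+1) D(i,j) = g(i,j) D(i,j+1) D(i+1,j).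
-- Along row i+1 the product of β therefore telescopes to
-- g(i,0)⋯g(i,b-2) · D(i,b-1) / D(i+1,b-1) = g(i,0)⋯g(i,b-1), and along row 0 to
-- C / D(0,b-1) = C / (g(0,b-1)⋯g(a-1,b-1)). The relations are invariant under
-- transposing P, which handles the columns.

open import Defs
open import Data.Nat using (ℕ; zero; suc; _∸_; _≤_; _<_; s≤s; s≤s⁻¹; z≤n; _≤?_; _<?_; NonZero; ≢-nonZero⁻¹)
import Data.Nat as ℕ
open import Data.Nat.Properties
  using (<⇒≤; ≤-refl; ≤-trans; n∸n≡0; m+n∸m≡n; m≤n+m; m+1+n≰m; +-monoʳ-≤; +-suc; m≤n⇒∃[o]m+o≡n; m∸[m∸n]≡n; ≤-<-connex; +-cancelˡ-≤)
import Data.Nat.Properties as ℕₚ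
open import Data.Fin using (Fin; zero; suc; toℕ; fromℕ<)
open import Data.Fin.Properties using (toℕ-fromℕ<; fromℕ<-toℕ; toℕ<n; toℕ-inject₁)
open import Data.Empty using (⊥-elim)
open import Data.Sum using (inj₁; inj₂)
open import Relation.Nullary using (yes; no)
open import Data.Product using (_×_; _,_; proj₁; proj₂; ∃-syntax)
open import Function using (flip)
open import Relation.Binary.PropositionalEquality as ≡ using (_≡_)

∀Fin⇒∀< : ∀ {n p} {P : ℕ → Set p} → (∀ (k : Fin n) → P (toℕ k)) → ∀ k → k < n → P k
∀Fin⇒∀< {P = P} h k k<n = ≡.subst P (toℕ-fromℕ< k<n) (h (fromℕ< k<n))

∀Fin⇒∀<₂ : ∀ {m n p} {P : ℕ → ℕ → Set p} → (∀ (i : Fin m) (j : Fin n) → P (toℕ i) (toℕ j)) →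
           ∀ i j → i < m → j < n → P i j
∀Fin⇒∀<₂ h i j i<m j<n = ∀Fin⇒∀< (λ i′ → ∀Fin⇒∀< (h i′) j j<n) i i<m

m∸n≡1+[m∸1+n] : ∀ {m n} → n < m → m ∸ n ≡ suc (m ∸ suc n)
m∸n≡1+[m∸1+n] {suc m} {zero}  _         = ≡.refl
m∸n≡1+[m∸1+n] {suc m} {suc n} (s≤s n<m) = m∸n≡1+[m∸1+n] n<m

m<n⇒∃[o]n≡m+1+o : ∀ {m n} → m < n → ∃[ o ] n ≡ m ℕ.+ suc o
m<n⇒∃[o]n≡m+1+o {m} m<n with m≤n⇒∃[o]m+o≡n m<n
... | o , 1+m+o≡n = o , ≡.trans (≡.sym 1+m+o≡n) (≡.sym (+-suc m o))

module FieldAlgebra {c ℓ} (K : Field c ℓ) where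
  open Field K hiding (zero)
  open import Algebra.Properties.CommutativeSemigroup *-commutativeSemigroup
    using (xy∙z≈xz∙y)
  open import Algebra.Solver.Ring.NaturalCoefficients.Default commutativeSemiring
  open import Relation.Binary.Reasoning.Setoid setoid

  infixl 7 _/_
  _/_ : Carrier → Carrier → Carrier
  x / y = x * y ⁻¹

  x*y/y≈x : ∀ x {y} → y ≉ 0# → x * y / y ≈ x
  x*y/y≈x x {y} y≉0 = begin
    x * y * y ⁻¹    ≈⟨ *-assoc x y (y ⁻¹) ⟩
    x * (y * y ⁻¹)  ≈⟨ *-congˡ (inverseʳ y y≉0) ⟩
    x * 1#          ≈⟨ *-identityʳ x ⟩
    x               ∎

  x/y*y≈x : ∀ x {y} → y ≉ 0# → x / y * y ≈ x
  x/y*y≈x x {y} y≉0 = trans (xy∙z≈xz∙y x (y ⁻¹) y) (x*y/y≈x x y≉0)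

  *-cancelʳ : ∀ {x y z} → z ≉ 0# → x * z ≈ y * z → x ≈ y
  *-cancelʳ {x} {y} {z} z≉0 xz≈yz = begin
    x          ≈⟨ sym (x*y/y≈x x z≉0) ⟩
    x * z / z  ≈⟨ *-congʳ xz≈yz ⟩
    y * z / z  ≈⟨ x*y/y≈x y z≉0 ⟩
    y          ∎

  x*y≈z⇒x≈z/y : ∀ {x y z} → y ≉ 0# → x * y ≈ z → x ≈ z / y
  x*y≈z⇒x≈z/y {x} {y} {z} y≉0 xy≈z = *-cancelʳ y≉0 (trans xy≈z (sym (x/y*y≈x z y≉0)))

  *-≉0 : ∀ {x y} → x ≉ 0# → y ≉ 0# → x * y ≉ 0#
  *-≉0 {x} {y} x≉0 y≉0 xy≈0 = y≉0 (*-cancelʳ x≉0 (trans (*-comm y x) (trans xy≈0 (sym (zeroˡ x)))))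

  x*y≈z⇒z/x≈y : ∀ {x y z} → z ≉ 0# → x * y ≈ z → z / x ≈ y
  x*y≈z⇒z/x≈y {x} {y} {z} z≉0 xy≈z = sym (x*y≈z⇒x≈z/y x≉0 (trans (*-comm y x) xy≈z))
    where
    x≉0 : x ≉ 0#
    x≉0 x≈0 = z≉0 (trans (sym xy≈z) (trans (*-congʳ x≈0) (zeroˡ y)))

  /-congˡ : ∀ x {y z} → y ≉ 0# → y ≈ z → x / y ≈ x / z
  /-congˡ x {y} {z} y≉0 y≈z = *-congˡ (*-cancelʳ y≉0 (begin
    y ⁻¹ * y  ≈⟨ *-comm (y ⁻¹) y ⟩
    y * y ⁻¹  ≈⟨ inverseʳ y y≉0 ⟩
    1#        ≈⟨ sym (inverseʳ z z≉0) ⟩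
    z * z ⁻¹  ≈⟨ *-comm z (z ⁻¹) ⟩
    z ⁻¹ * z  ≈⟨ *-congˡ (sym y≈z) ⟩
    z ⁻¹ * y  ∎))
    where
    z≉0 : z ≉ 0#
    z≉0 z≈0 = y≉0 (trans y≈z z≈0)

  x/1≈x : ∀ x → x / 1# ≈ x
  x/1≈x x = trans (*-congʳ (sym (*-identityʳ x))) (x*y/y≈x x 1≉0)

  [x/y]/z*y≈x/z : ∀ x {y} z → y ≉ 0# → x / y / z * y ≈ x / z
  [x/y]/z*y≈x/z x {y} z y≉0 = begin
    x / y / z * y    ≈⟨ *-congʳ (xy∙z≈xz∙y x (y ⁻¹) (z ⁻¹)) ⟩
    x / z / y * y    ≈⟨ x/y*y≈x (x / z) y≉0 ⟩
    x / z            ∎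

  x/[x/y]≈y : ∀ x {y} → y ≉ 0# → x / y ≉ 0# → x / (x / y) ≈ y
  x/[x/y]≈y x {y} y≉0 x/y≉0 = sym (x*y≈z⇒x≈z/y x/y≉0 (trans (*-comm y (x / y)) (x/y*y≈x x y≉0)))

  x/[x/y+x/z]*[z+y]≈y*z : ∀ x {y z} → y ≉ 0# → z ≉ 0# → x / y + x / z ≉ 0# →
                          x / (x / y + x / z) * (z + y) ≈ y * z
  x/[x/y+x/z]*[z+y]≈y*z x {y} {z} y≉0 z≉0 s≉0 = begin
    x / s * (z + y)    ≈⟨ xy∙z≈xz∙y x (s ⁻¹) (z + y) ⟩
    x * (z + y) / s    ≈⟨ sym (*-congʳ sum-of-fractions) ⟩
    y * z * s / s      ≈⟨ x*y/y≈x (y * z) s≉0 ⟩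
    y * z              ∎
    where
    s : Carrier
    s = x / y + x / z
    sum-of-fractions : y * z * s ≈ x * (z + y)
    sum-of-fractions = begin
      y * z * (x / y + x / z)
        ≈⟨ solve 5 (λ x y z y⁻¹ z⁻¹ → y :* z :* (x :* y⁻¹ :+ x :* z⁻¹) := x :* z :* (y :* y⁻¹) :+ x :* y :* (z :* z⁻¹))
                   refl x y z (y ⁻¹) (z ⁻¹) ⟩
      x * z * (y * y ⁻¹) + x * y * (z * z ⁻¹)
        ≈⟨ +-cong (*-congˡ (inverseʳ y y≉0)) (*-congˡ (inverseʳ z z≉0)) ⟩
      x * z * 1# + x * y * 1#
        ≈⟨ solve 3 (λ x y z → x :* z :* con 1 :+ x :* y :* con 1 := x :* (z :+ y)) refl x y z ⟩
      x * (z + y)  ∎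

module Products {c ℓ} (K : Field c ℓ) where
  open Field K hiding (zero)
  open FieldOps K using (prodFin)
  open FieldAlgebra K using (*-≉0; *-cancelʳ)
  open import Algebra.Properties.CommutativeSemigroup *-commutativeSemigroup
    using (x∙yz≈xy∙z)
  open import Algebra.Solver.Ring.NaturalCoefficients.Default commutativeSemiring
  open import Relation.Binary.Reasoning.Setoid setoid

  ∏ : (ℕ → Carrier) → ℕ → Carrier
  ∏ f n = prodFin {n} (λ k → f (toℕ k))

  ∏-snoc : ∀ f n → ∏ f (suc n) ≈ ∏ f n * f n
  ∏-snoc f zero    = *-comm (f 0) 1#
  ∏-snoc f (suc n) = begin
    f 0 * ∏ (λ k → f (suc k)) (suc n)        ≈⟨ *-congˡ (∏-snoc (λ k → f (suc k)) n) ⟩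
    f 0 * (∏ (λ k → f (suc k)) n * f (suc n)) ≈⟨ x∙yz≈xy∙z (f 0) _ (f (suc n)) ⟩
    f 0 * ∏ (λ k → f (suc k)) n * f (suc n)   ∎

  ∏-≉0 : ∀ f n → (∀ k → k < n → f k ≉ 0#) → ∏ f n ≉ 0#
  ∏-≉0 f zero    _   = 1≉0
  ∏-≉0 f (suc n) f≉0 = *-≉0 (f≉0 0 (s≤s z≤n)) (∏-≉0 (λ k → f (suc k)) n (λ k k<n → f≉0 (suc k) (s≤s k<n)))

  ∏-1 : ∀ n → ∏ (λ _ → 1#) n ≈ 1#
  ∏-1 zero    = refl
  ∏-1 (suc n) = trans (*-identityˡ _) (∏-1 n)

  ∏-from-recurrence : ∀ (f g : ℕ → Carrier) m → f m ≈ g m →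
                      (∀ i → i < m → f i ≈ g i * f (suc i)) → f 0 ≈ ∏ g (suc m)
  ∏-from-recurrence f g zero    last _    = trans last (sym (*-identityʳ (g 0)))
  ∏-from-recurrence f g (suc m) last step = trans (step 0 (s≤s z≤n))
    (*-congˡ (∏-from-recurrence (λ i → f (suc i)) (λ i → g (suc i)) m last (λ i i<m → step (suc i) (s≤s i<m))))

  telescope : ∀ (x y u v : ℕ → Carrier) m →
    x 0 * v 0 ≈ u 0 →
    (∀ k → k < m → u k ≉ 0#) →
    (∀ k → k < m → x (suc k) * v (suc k) * u k ≈ y k * u (suc k) * v k) →
    ∏ x (suc m) * v m ≈ ∏ y m * u m
  telescope x y u v zero base _ _ =
    trans (*-congʳ (*-identityʳ (x 0))) (trans base (sym (*-identityˡ (u 0))))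
  telescope x y u v (suc m) base u≉0 step = *-cancelʳ (u≉0 m ≤-refl) (begin
    ∏ x (suc (suc m)) * v (suc m) * u m         ≈⟨ *-congʳ (*-congʳ (∏-snoc x (suc m))) ⟩
    X * x (suc m) * v (suc m) * u m
      ≈⟨ solve 4 (λ X a b c → X :* a :* b :* c := X :* (a :* b :* c)) refl X (x (suc m)) (v (suc m)) (u m) ⟩
    X * (x (suc m) * v (suc m) * u m)           ≈⟨ *-congˡ (step m ≤-refl) ⟩
    X * (y m * u (suc m) * v m)
      ≈⟨ solve 4 (λ X a b c → X :* (a :* b :* c) := X :* c :* (a :* b)) refl X (y m) (u (suc m)) (v m) ⟩
    X * v m * (y m * u (suc m))                 ≈⟨ *-congʳ IH ⟩
    ∏ y m * u m * (y m * u (suc m))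
      ≈⟨ solve 4 (λ Y c a b → Y :* c :* (a :* b) := Y :* a :* b :* c) refl (∏ y m) (u m) (y m) (u (suc m)) ⟩
    ∏ y m * y m * u (suc m) * u m               ≈⟨ *-congʳ (*-congʳ (sym (∏-snoc y m))) ⟩
    ∏ y (suc m) * u (suc m) * u m               ∎)
    where
    X : Carrier
    X = ∏ x (suc m)
    IH : X * v m ≈ ∏ y m * u m
    IH = telescope x y u v m base (λ k k<m → u≉0 k (<⇒≤ (s≤s k<m))) (λ k k<m → step k (<⇒≤ (s≤s k<m)))

module Grid {c ℓ} (K : Field c ℓ) where
  open Field K hiding (zero)
  open FieldAlgebra K using (*-cancelʳ)
  open Products K
  open import Algebra.Properties.CommutativeSemigroup *-commutativeSemigroup
    using (xy∙z≈xz∙y; x∙yz≈xy∙z)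
  open import Relation.Binary.Reasoning.Setoid setoid

  record LocalRelations (m n : ℕ) (C : Carrier) (G D β : ℕ → ℕ → Carrier) : Set ℓ where
    field
      C≉0        : C ≉ 0#
      D≉0        : ∀ i j → i ≤ m → j ≤ n → D i j ≉ 0#
      D-corner   : D m n ≈ G m n
      D-lastCol  : ∀ i → i < m → D i n ≈ G i n * D (suc i) n
      D-lastRow  : ∀ j → j < n → D m j ≈ G m j * D m (suc j)
      β-corner   : β 0 0 * D 0 0 ≈ C
      β-firstCol : ∀ i → i < m → β (suc i) 0 * D (suc i) 0 ≈ D i 0
      β-firstRow : ∀ j → j < n → β 0 (suc j) * D 0 (suc j) ≈ D 0 j
      β-interior : ∀ i j → i < m → j < n →
        β (suc i) (suc j) * D (suc i) (suc j) * D i j ≈ G i j * D i (suc j) * D (suc i) j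

    D-lastCol-∏ : D 0 n ≈ ∏ (λ i → G i n) (suc m)
    D-lastCol-∏ = ∏-from-recurrence (λ i → D i n) (λ i → G i n) m D-corner D-lastCol

    β-firstRow-∏ : ∏ (β 0) (suc n) * D 0 n ≈ C
    β-firstRow-∏ = trans telescoped (trans (*-congʳ (∏-1 n)) (*-identityˡ C))
      where
      telescoped : ∏ (β 0) (suc n) * D 0 n ≈ ∏ (λ _ → 1#) n * C
      telescoped = telescope (β 0) (λ _ → 1#) (λ _ → C) (D 0) n β-corner (λ _ _ → C≉0)
        (λ k k<n → trans (*-congʳ (β-firstRow k k<n)) (trans (*-comm (D 0 k) C) (sym (*-congʳ (*-identityˡ C)))))

    β-row-∏ : ∀ r → r < m → ∏ (β (suc r)) (suc n) ≈ ∏ (G r) (suc n)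
    β-row-∏ r r<m = *-cancelʳ (D≉0 (suc r) n r<m ≤-refl) (begin
      ∏ (β (suc r)) (suc n) * D (suc r) n  ≈⟨ telescoped ⟩
      ∏ (G r) n * D r n                    ≈⟨ *-congˡ (D-lastCol r r<m) ⟩
      ∏ (G r) n * (G r n * D (suc r) n)    ≈⟨ x∙yz≈xy∙z (∏ (G r) n) (G r n) (D (suc r) n) ⟩
      ∏ (G r) n * G r n * D (suc r) n      ≈⟨ *-congʳ (sym (∏-snoc (G r) n)) ⟩
      ∏ (G r) (suc n) * D (suc r) n        ∎)
      where
      telescoped : ∏ (β (suc r)) (suc n) * D (suc r) n ≈ ∏ (G r) n * D r n
      telescoped = telescope (β (suc r)) (G r) (D r) (D (suc r)) n (β-firstCol r r<m)
        (λ k k<n → D≉0 r k (<⇒≤ r<m) (<⇒≤ k<n)) (λ k → β-interior r k r<m)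

  transpose : ∀ {m n C G D β} → LocalRelations m n C G D β →
              LocalRelations n m C (flip G) (flip D) (flip β)
  transpose R = record
    { C≉0        = C≉0
    ; D≉0        = λ i j i≤n j≤m → D≉0 j i j≤m i≤n
    ; D-corner   = D-corner
    ; D-lastCol  = D-lastRow
    ; D-lastRow  = D-lastCol
    ; β-corner   = β-corner
    ; β-firstCol = β-firstRow
    ; β-firstRow = β-firstCol
    ; β-interior = λ i j i<n j<m → trans (β-interior j i j<m i<n) (xy∙z≈xz∙y _ _ _)
    }
    where open LocalRelations R

module PosetProperties {c ℓ} (K : Field c ℓ) (a b : ℕ) where
  open Field K using (_≉_; _+_; _*_; 0#; 1#)
  open FieldAlgebra K using (_/_)
  open Products K using (∏)
  open Poset K a b

  ext-toℕ : ∀ (f : Lab) i j → ext f (toℕ i) (toℕ j) ≡ f i j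
  ext-toℕ f i j with toℕ i <? a | toℕ j <? b
  ... | yes i<a | yes j<b = ≡.cong₂ f (fromℕ<-toℕ i i<a) (fromℕ<-toℕ j j<b)
  ... | no i≮a  | _       = ⊥-elim (i≮a (toℕ<n i))
  ... | yes _   | no j≮b  = ⊥-elim (j≮b (toℕ<n j))

  ext-≉0 : ∀ (f : Lab) → (∀ i j → f i j ≉ 0#) → ∀ i j → i < a → j < b → ext f i j ≉ 0#
  ext-≉0 f f≉0 = ∀Fin⇒∀<₂ (λ i j → ≡.subst (_≉ 0#) (≡.sym (ext-toℕ f i j)) (f≉0 i j))

  ST-row : ∀ C f i → 1 ≤ i → i ≤ a → ST C f i ≡ ∏ (ext f (i ∸ 1)) b
  ST-row C f i 1≤i i≤a with 1 ≤? i | i ≤? a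
  ... | yes _    | yes _   = ≡.refl
  ... | no 1≰i   | _       = ⊥-elim (1≰i 1≤i)
  ... | yes _    | no i≰a  = ⊥-elim (i≰a i≤a)

  ST-col : ∀ C f c → c < b → ST C f (a ℕ.+ suc c) ≡ C / ∏ (λ k → ext f k c) a
  ST-col C f c c<b with 1 ≤? a ℕ.+ suc c | a ℕ.+ suc c ≤? a | a ℕ.+ suc c ≤? a ℕ.+ b
  ... | yes _   | no _     | yes _ = ≡.cong (λ t → C / ∏ (λ k → ext f k (t ∸ 1)) a) (m+n∸m≡n a (suc c))
  ... | no 1≰i  | _        | _     = ⊥-elim (1≰i (≤-trans (s≤s z≤n) (m≤n+m (suc c) a)))
  ... | yes _   | yes i≤a  | _     = ⊥-elim (m+1+n≰m a i≤a)
  ... | yes _   | no _     | no i≰ = ⊥-elim (i≰ (+-monoʳ-≤ a c<b))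

  Dist-interior : ∀ h {m n i j} → i < m → j < n →
    Dist h (m ∸ i) (n ∸ j) ≡ h (m ∸ i) (n ∸ j) * (Dist h (m ∸ suc i) (n ∸ j) + Dist h (m ∸ i) (n ∸ suc j))
  Dist-interior h i<m j<n rewrite m∸n≡1+[m∸1+n] i<m | m∸n≡1+[m∸1+n] j<n = ≡.refl

  Dist-lastCol : ∀ h {m i} n → i < m → Dist h (m ∸ i) (n ∸ n) ≡ h (m ∸ i) (n ∸ n) * Dist h (m ∸ suc i) (n ∸ n)
  Dist-lastCol h n i<m rewrite m∸n≡1+[m∸1+n] i<m | n∸n≡0 n = ≡.refl

  Dist-lastRow : ∀ h m {n j} → j < n → Dist h (m ∸ m) (n ∸ j) ≡ h (m ∸ m) (n ∸ j) * Dist h (m ∸ m) (n ∸ suc j)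
  Dist-lastRow h m j<n rewrite n∸n≡0 m | m∸n≡1+[m∸1+n] j<n = ≡.refl

  Dist-corner : ∀ h m n → Dist h (m ∸ m) (n ∸ n) ≡ h (m ∸ m) (n ∸ n) * 1#
  Dist-corner h m n rewrite n∸n≡0 m | n∸n≡0 n = ≡.refl

module Rowmotion {c ℓ} (K : Field c ℓ) (a' b' : ℕ) (C : Field.Carrier K)
                 (g : Poset.Lab K (suc a') (suc b'))
                 (gen : Poset.Generic K (suc a') (suc b') C g) where
  open Field K hiding (zero)
  open FieldAlgebra K
  open Products K
  open Grid K
  open Poset K (suc a') (suc b')
  open PosetProperties K (suc a') (suc b')
  open import Algebra.Properties.CommutativeSemigroup *-commutativeSemigroup using (x∙yz≈y∙xz)
  open import Relation.Binary.Reasoning.Setoid setoid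

  -- D is Δ⁻¹ g read in the coordinates of P; Ĝ is g in the distance-from-the-top
  -- coordinates in which Dist computes.
  G Ĝ D β : ℕ → ℕ → Carrier
  G = ext g
  Ĝ p q = G (a' ∸ p) (b' ∸ q)
  D i j = Dist Ĝ (a' ∸ i) (b' ∸ j)
  β = ext (BAR C g)

  L : Lab
  L = lowerSum (Θ C (Δinv g))

  C≉0 : C ≉ 0#
  C≉0 = proj₁ gen

  g≉0 : ∀ i j → g i j ≉ 0#
  g≉0 = proj₁ (proj₂ gen)

  Δinv≉0 : ∀ i j → D (toℕ i) (toℕ j) ≉ 0#
  Δinv≉0 = proj₁ (proj₂ (proj₂ gen))

  L≉0 : ∀ i j → L i j ≉ 0#
  L≉0 = proj₁ (proj₂ (proj₂ (proj₂ gen)))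

  D≉0 : ∀ i j → i ≤ a' → j ≤ b' → D i j ≉ 0#
  D≉0 i j i≤a' j≤b' = ∀Fin⇒∀<₂ {P = λ i j → D i j ≉ 0#} Δinv≉0 i j (s≤s i≤a') (s≤s j≤b')

  Ĝ-∸ : ∀ {i j} → i ≤ a' → j ≤ b' → Ĝ (a' ∸ i) (b' ∸ j) ≡ G i j
  Ĝ-∸ i≤a' j≤b' = ≡.cong₂ G (m∸[m∸n]≡n i≤a') (m∸[m∸n]≡n j≤b')

  D-interior : ∀ i j → i < a' → j < b' → D i j ≈ G i j * (D (suc i) j + D i (suc j))
  D-interior i j i<a' j<b' = reflexive (≡.trans (Dist-interior Ĝ i<a' j<b')
    (≡.cong (_* (D (suc i) j + D i (suc j))) (Ĝ-∸ (<⇒≤ i<a') (<⇒≤ j<b'))))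

  D-lastCol : ∀ i → i < a' → D i b' ≈ G i b' * D (suc i) b'
  D-lastCol i i<a' = reflexive (≡.trans (Dist-lastCol Ĝ b' i<a')
    (≡.cong (_* D (suc i) b') (Ĝ-∸ (<⇒≤ i<a') ≤-refl)))

  D-lastRow : ∀ j → j < b' → D a' j ≈ G a' j * D a' (suc j)
  D-lastRow j j<b' = reflexive (≡.trans (Dist-lastRow Ĝ a' j<b')
    (≡.cong (_* D a' (suc j)) (Ĝ-∸ ≤-refl (<⇒≤ j<b'))))

  D-corner : D a' b' ≈ G a' b'
  D-corner = trans (reflexive (≡.trans (Dist-corner Ĝ a' b') (≡.cong (_* 1#) (Ĝ-∸ ≤-refl ≤-refl))))
                   (*-identityʳ (G a' b'))

  β*D≈C/L : ∀ i j → β (toℕ i) (toℕ j) * D (toℕ i) (toℕ j) ≈ C / L i j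
  β*D≈C/L i j = trans (*-congʳ (reflexive (ext-toℕ (BAR C g) i j))) ([x/y]/z*y≈x/z C (L i j) (Δinv≉0 i j))

  L-firstCol : ∀ (i : Fin a') → L (suc i) zero ≡ C / D (toℕ i) 0
  L-firstCol i = ≡.cong (λ k → C / D k 0) (toℕ-inject₁ i)

  L-firstRow : ∀ (j : Fin b') → L zero (suc j) ≡ C / D 0 (toℕ j)
  L-firstRow j = ≡.cong (λ k → C / D 0 k) (toℕ-inject₁ j)

  L-interior : ∀ (i : Fin a') (j : Fin b') →
    L (suc i) (suc j) ≡ C / D (toℕ i) (suc (toℕ j)) + C / D (suc (toℕ i)) (toℕ j)
  L-interior i j = ≡.cong₂ (λ k l → C / D k (suc (toℕ j)) + C / D (suc (toℕ i)) l) (toℕ-inject₁ i) (toℕ-inject₁ j)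

  β-firstCol : ∀ i → i < a' → β (suc i) 0 * D (suc i) 0 ≈ D i 0
  β-firstCol = ∀Fin⇒∀< {P = λ i → β (suc i) 0 * D (suc i) 0 ≈ D i 0} λ i → begin
    β (suc (toℕ i)) 0 * D (suc (toℕ i)) 0  ≈⟨ β*D≈C/L (suc i) zero ⟩
    C / L (suc i) zero                     ≡⟨ ≡.cong (C /_) (L-firstCol i) ⟩
    C / (C / D (toℕ i) 0)                  ≈⟨ x/[x/y]≈y C (D≉0 (toℕ i) 0 (<⇒≤ (toℕ<n i)) z≤n)
                                                  (≡.subst (_≉ 0#) (L-firstCol i) (L≉0 (suc i) zero)) ⟩
    D (toℕ i) 0                            ∎

  β-firstRow : ∀ j → j < b' → β 0 (suc j) * D 0 (suc j) ≈ D 0 j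
  β-firstRow = ∀Fin⇒∀< {P = λ j → β 0 (suc j) * D 0 (suc j) ≈ D 0 j} λ j → begin
    β 0 (suc (toℕ j)) * D 0 (suc (toℕ j))  ≈⟨ β*D≈C/L zero (suc j) ⟩
    C / L zero (suc j)                     ≡⟨ ≡.cong (C /_) (L-firstRow j) ⟩
    C / (C / D 0 (toℕ j))                  ≈⟨ x/[x/y]≈y C (D≉0 0 (toℕ j) z≤n (<⇒≤ (toℕ<n j)))
                                                  (≡.subst (_≉ 0#) (L-firstRow j) (L≉0 zero (suc j))) ⟩
    D 0 (toℕ j)                            ∎

  β-interior : ∀ i j → i < a' → j < b' →
    β (suc i) (suc j) * D (suc i) (suc j) * D i j ≈ G i j * D i (suc j) * D (suc i) j
  β-interior = ∀Fin⇒∀<₂ {P = λ i j → β (suc i) (suc j) * D (suc i) (suc j) * D i j ≈ G i j * D i (suc j) * D (suc i) j}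
                        β-interior-Fin
    where
    β-interior-Fin : ∀ (i : Fin a') (j : Fin b') → let i′ = toℕ i; j′ = toℕ j in
      β (suc i′) (suc j′) * D (suc i′) (suc j′) * D i′ j′ ≈ G i′ j′ * D i′ (suc j′) * D (suc i′) j′
    β-interior-Fin i j = begin
      β (suc i′) (suc j′) * D (suc i′) (suc j′) * D i′ j′  ≈⟨ *-congʳ (β*D≈C/L (suc i) (suc j)) ⟩
      C / L (suc i) (suc j) * D i′ j′                      ≡⟨ ≡.cong (λ s → C / s * D i′ j′) (L-interior i j) ⟩
      C / s * D i′ j′                                      ≈⟨ *-congˡ (D-interior i′ j′ (toℕ<n i) (toℕ<n j)) ⟩
      C / s * (G i′ j′ * (D (suc i′) j′ + D i′ (suc j′)))  ≈⟨ x∙yz≈y∙xz (C / s) (G i′ j′) _ ⟩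
      G i′ j′ * (C / s * (D (suc i′) j′ + D i′ (suc j′)))  ≈⟨ *-congˡ (x/[x/y+x/z]*[z+y]≈y*z C
                                                                (D≉0 i′ (suc j′) (<⇒≤ (toℕ<n i)) (toℕ<n j))
                                                                (D≉0 (suc i′) j′ (toℕ<n i) (<⇒≤ (toℕ<n j)))
                                                                (≡.subst (_≉ 0#) (L-interior i j) (L≉0 (suc i) (suc j)))) ⟩
      G i′ j′ * (D i′ (suc j′) * D (suc i′) j′)            ≈⟨ sym (*-assoc (G i′ j′) _ _) ⟩
      G i′ j′ * D i′ (suc j′) * D (suc i′) j′              ∎
      where
      i′ j′ : ℕ
      i′ = toℕ i
      j′ = toℕ j
      s : Carrier
      s = C / D i′ (suc j′) + C / D (suc i′) j′

  relations : LocalRelations a' b' C G D β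
  relations = record
    { C≉0        = C≉0
    ; D≉0        = D≉0
    ; D-corner   = D-corner
    ; D-lastCol  = D-lastCol
    ; D-lastRow  = D-lastRow
    ; β-corner   = trans (β*D≈C/L zero zero) (x/1≈x C)
    ; β-firstCol = β-firstCol
    ; β-firstRow = β-firstRow
    ; β-interior = β-interior
    }

  module R  = LocalRelations relations
  module Rᵀ = LocalRelations (transpose relations)

  ST-BAR-row : ∀ i → 2 ≤ i → i ≤ suc a' → ST C (BAR C g) i ≈ ST C g (i ∸ 1)
  ST-BAR-row (suc (suc r)) (s≤s (s≤s z≤n)) (s≤s r<a') = begin
    ST C (BAR C g) (suc (suc r))  ≡⟨ ST-row C (BAR C g) (suc (suc r)) (s≤s z≤n) (s≤s r<a') ⟩
    ∏ (β (suc r)) (suc b')         ≈⟨ R.β-row-∏ r r<a' ⟩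
    ∏ (G r) (suc b')               ≡⟨ ≡.sym (ST-row C g (suc r) (s≤s z≤n) (<⇒≤ (s≤s r<a'))) ⟩
    ST C g (suc r)                 ∎

  ST-BAR-firstCol : ST C (BAR C g) (suc a' ℕ.+ 1) ≈ ST C g (suc a')
  ST-BAR-firstCol = begin
    ST C (BAR C g) (suc a' ℕ.+ 1)  ≡⟨ ST-col C (BAR C g) 0 (s≤s z≤n) ⟩
    C / ∏ (λ k → β k 0) (suc a')   ≈⟨ x*y≈z⇒z/x≈y C≉0 Rᵀ.β-firstRow-∏ ⟩
    D a' 0                         ≈⟨ Rᵀ.D-lastCol-∏ ⟩
    ∏ (G a') (suc b')              ≡⟨ ≡.sym (ST-row C g (suc a') (s≤s z≤n) ≤-refl) ⟩
    ST C g (suc a')                ∎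

  ST-BAR-col : ∀ c → c < b' → ST C (BAR C g) (suc a' ℕ.+ suc (suc c)) ≈ ST C g (suc a' ℕ.+ suc c)
  ST-BAR-col c c<b' = begin
    ST C (BAR C g) (suc a' ℕ.+ suc (suc c))  ≡⟨ ST-col C (BAR C g) (suc c) (s≤s c<b') ⟩
    C / ∏ (λ k → β k (suc c)) (suc a')       ≈⟨ sym (/-congˡ C ∏G≉0 (sym (Rᵀ.β-row-∏ c c<b'))) ⟩
    C / ∏ (λ k → G k c) (suc a')             ≡⟨ ≡.sym (ST-col C g c (<⇒≤ (s≤s c<b'))) ⟩
    ST C g (suc a' ℕ.+ suc c)                ∎
    where
    ∏G≉0 : ∏ (λ k → G k c) (suc a') ≉ 0#
    ∏G≉0 = ∏-≉0 (λ k → G k c) (suc a') (λ k k<a → ext-≉0 g g≉0 k c k<a (<⇒≤ (s≤s c<b')))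

  ST-BAR-shift : ∀ i → 2 ≤ i → i ≤ suc a' ℕ.+ suc b' → ST C (BAR C g) i ≈ ST C g (i ∸ 1)
  ST-BAR-shift i 2≤i i≤a+b with ≤-<-connex i (suc a')
  ... | inj₁ i≤a = ST-BAR-row i 2≤i i≤a
  ... | inj₂ a<i with m<n⇒∃[o]n≡m+1+o a<i
  ...   | zero  , ≡.refl = trans ST-BAR-firstCol (reflexive (≡.cong (ST C g) (ℕₚ.+-comm 1 a')))
  ...   | suc c , ≡.refl = trans (ST-BAR-col c (s≤s⁻¹ (+-cancelˡ-≤ (suc a') _ _ i≤a+b)))
                                 (reflexive (≡.cong (ST C g) (≡.sym (+-suc a' (suc c)))))

  ST-BAR-first : ST C (BAR C g) 1 ≈ ST C g (suc a' ℕ.+ suc b')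
  ST-BAR-first = begin
    ST C (BAR C g) 1                 ≡⟨ ST-row C (BAR C g) 1 (s≤s z≤n) (s≤s z≤n) ⟩
    ∏ (β 0) (suc b')                 ≈⟨ x*y≈z⇒x≈z/y D0b≉0 R.β-firstRow-∏ ⟩
    C / D 0 b'                       ≈⟨ /-congˡ C D0b≉0 R.D-lastCol-∏ ⟩
    C / ∏ (λ k → G k b') (suc a')    ≡⟨ ≡.sym (ST-col C g b' ≤-refl) ⟩
    ST C g (suc a' ℕ.+ suc b')       ∎
    where
    D0b≉0 : D 0 b' ≉ 0#
    D0b≉0 = D≉0 0 b' z≤n ≤-refl

open import Data.Nat using (_+_)

theorem3p10 : ∀ {c ℓ} (K : Field c ℓ) → FieldOps.CharZero K →
    (a b : ℕ) → .{{NonZero a}} → .{{NonZero b}} →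
    (C : Field.Carrier K) (g : Poset.Lab K a b) →
    Poset.Generic K a b C g →
    ((i : ℕ) → 2 ≤ i → i ≤ a + b →
      Field._≈_ K (Poset.ST K a b C (Poset.BAR K a b C g) i) (Poset.ST K a b C g (i ∸ 1)))
    × Field._≈_ K (Poset.ST K a b C (Poset.BAR K a b C g) 1) (Poset.ST K a b C g (a + b))
theorem3p10 K _ zero     _        {{a≢0}}         C g _   = ⊥-elim (≢-nonZero⁻¹ 0 {{a≢0}} ≡.refl)
theorem3p10 K _ (suc a') zero     {{_}} {{b≢0}}   C g _   = ⊥-elim (≢-nonZero⁻¹ 0 {{b≢0}} ≡.refl)
theorem3p10 K _ (suc a') (suc b') C g gen = ST-BAR-shift , ST-BAR-first
  where open Rowmotion K a' b' C g gen
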